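{- Let $n$ be an integer with $n \geq 2$. A matroid $M$ is $U_{n,n}$-connected if and only if $M$ is simple and has rank at least $n$.
   Context: A matroid $M$ with $|E(M)| \geq 2$ is $N$-connected if for every pair of distinct elements $e,f \in E(M)$ there is a minor of $M$ isomorphic to $N$ whose ground set contains $\{e,f\}$. -}

module Defs where

open import Data.Nat using (ℕ; _≤_; _<_)
open import Data.Fin using (Fin)
open import Data.Fin.Subset
  using (Subset; ⁅_⁆; _∈_; _∉_; _⊆_; ∁; _∩_; _∪_; ∣_∣; Empty)
  renaming (⊥ to ∅)
open import Data.Vec using (tabulate; lookup)
open import Data.Product using (Σ; ∃; _×_)
open import Relation.Binary.PropositionalEquality using (_≡_; _≢_)
open import Relation.Nullary using (¬_)
open import Function using (Injective)
open import Function.Bundles using (_⇔_)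

record Matroid (m : ℕ) : Set₁ where
  field
    Indep    : Subset m → Set
    indep-∅  : Indep ∅
    indep-⊆  : ∀ {X Y} → X ⊆ Y → Indep Y → Indep X
    augment  : ∀ {X Y} → Indep X → Indep Y → ∣ X ∣ < ∣ Y ∣ →
               ∃ λ y → y ∈ Y × y ∉ X × Indep (X ∪ ⁅ y ⁆)
open Matroid public

IndepSystem : ℕ → Set₁
IndepSystem k = Subset k → Set

U : ℕ → (k : ℕ) → IndepSystem k
U r k X = ∣ X ∣ ≤ r

module _ {m : ℕ} (M : Matroid m) where

  -- ground set of the minor M / C \ D
  MinorGround : Subset m → Subset m → Subset m
  MinorGround C D = ∁ (C ∪ D)

  BasisOf : Subset m → Subset m → Set
  BasisOf C J = J ⊆ C × Indep M J ×
                (∀ x → x ∈ C → x ∉ J → ¬ Indep M (J ∪ ⁅ x ⁆))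

  MinorIndep : Subset m → Subset m → Subset m → Set
  MinorIndep C D X = X ⊆ MinorGround C D ×
    (∃ λ J → BasisOf C J × Indep M (X ∪ J))

  MinorIso : ∀ {k} → Subset m → Subset m → IndepSystem k → Set
  MinorIso {k} C D N =
    Σ (Fin k → Fin m) λ φ →
      Injective _≡_ _≡_ φ ×
      (∀ x → x ∈ MinorGround C D ⇔ (∃ λ i → φ i ≡ x)) ×
      (∀ X → X ⊆ MinorGround C D →
         MinorIndep C D X ⇔ N (tabulate (λ i → lookup X (φ i))))

  NConnected : ∀ {k} → IndepSystem k → Set
  NConnected N = 2 ≤ m ×
    (∀ e f → e ≢ f →
       ∃ λ C → ∃ λ D → Empty (C ∩ D) ×
         e ∈ MinorGround C D × f ∈ MinorGround C D × MinorIso C D N)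

  Simple : Set
  Simple = (∀ e → Indep M ⁅ e ⁆) ×
           (∀ e f → e ≢ f → Indep M (⁅ e ⁆ ∪ ⁅ f ⁆))

  RankAtLeast : ℕ → Set
  RankAtLeast n = ∃ λ X → Indep M X × n ≤ ∣ X ∣

-- A minor isomorphic to the free matroid U_{k,k} has an independent ground set
-- of size k, so N-connectivity for N = U_{n,n} makes every pair {e, f}
-- independent (no loops, no parallel pairs) and gives an independent set of
-- size n. Conversely, in a simple matroid of rank at least n every pair {e, f}
-- is independent and, by augmentation, lies in an independent n-set B; the
-- restriction M | B = M / ∅ \ (E − B) is then a copy of U_{n,n} through e and f.
module Submission where

open import Defs
open import Data.Bool.Properties using (not-involutive)
open import Data.Empty using (⊥-elim)
open import Data.Fin using (Fin; zero; suc)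
open import Data.Fin.Properties using (injective⇒≤; suc-injective)
open import Data.Fin.Subset
  using (Subset; ⁅_⁆; _∈_; _∉_; _⊆_; ∁; _∩_; _∪_; ∣_∣; Empty; inside; outside)
  renaming (⊥ to ∅)
open import Data.Fin.Subset.Properties
  using ( ∣p∣≤n; ⊆-refl; p⊆p∪q; x∈p∪q⁻; x∈p∪q⁺; ∉⊥; x∈⁅x⁆; x∈⁅y⁆⇒x≡y
        ; x≢y⇒x∉⁅y⁆; ∣⁅x⁆∣≡1; ∪-identityˡ; ∪-identityʳ; ∩-zeroˡ )
open import Data.Nat using (ℕ; _≤_; _+_; zero; suc; z≤n; s≤s; z<s)
open import Data.Nat.Properties
  using (≤-trans; <-≤-trans; m<m+n; +-suc; +-identityʳ; m≤n⇒∃[o]m+o≡n)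
open import Data.Product using (_×_; _,_; ∃)
open import Data.Sum using (inj₁; inj₂)
open import Data.Vec using ([]; _∷_; here; there; tabulate; lookup)
open import Function using (Injective)
open import Function.Bundles using (_⇔_; mk⇔; Equivalence)
open import Relation.Binary.PropositionalEquality
  using (_≡_; _≢_; refl; sym; trans; cong; cong₂; subst; module ≡-Reasoning)

open Equivalence using (from)

enumerate : ∀ {m} (X : Subset m) → Fin ∣ X ∣ → Fin m
enumerate (inside  ∷ X) zero    = zero
enumerate (inside  ∷ X) (suc i) = suc (enumerate X i)
enumerate (outside ∷ X) i       = suc (enumerate X i)

enumerate-∈ : ∀ {m} (X : Subset m) i → enumerate X i ∈ X
enumerate-∈ (inside  ∷ X) zero    = here
enumerate-∈ (inside  ∷ X) (suc i) = there (enumerate-∈ X i)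
enumerate-∈ (outside ∷ X) i       = there (enumerate-∈ X i)

enumerate-injective : ∀ {m} (X : Subset m) → Injective _≡_ _≡_ (enumerate X)
enumerate-injective (inside  ∷ X) {zero}  {zero}  _ = refl
enumerate-injective (inside  ∷ X) {suc i} {suc j} e =
  cong suc (enumerate-injective X (suc-injective e))
enumerate-injective (outside ∷ X) e = enumerate-injective X (suc-injective e)

index : ∀ {m} (X : Subset m) {x} → x ∈ X → Fin ∣ X ∣
index (inside  ∷ X) here      = zero
index (inside  ∷ X) (there p) = suc (index X p)
index (outside ∷ X) (there p) = index X p

enumerate-index : ∀ {m} (X : Subset m) {x} (p : x ∈ X) → enumerate X (index X p) ≡ x
enumerate-index (inside  ∷ X) here      = refl
enumerate-index (inside  ∷ X) (there p) = cong suc (enumerate-index X p)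
enumerate-index (outside ∷ X) (there p) = cong suc (enumerate-index X p)

injection-into⇒≤∣∣ : ∀ {k m} (φ : Fin k → Fin m) → Injective _≡_ _≡_ φ →
                     (X : Subset m) → (∀ i → φ i ∈ X) → k ≤ ∣ X ∣
injection-into⇒≤∣∣ φ φ-inj X φ∈X = injective⇒≤ ψ-inj
  where
  ψ-inj : Injective _≡_ _≡_ (λ i → index X (φ∈X i))
  ψ-inj {i} {j} e = φ-inj (begin
    φ i                           ≡⟨ sym (enumerate-index X (φ∈X i)) ⟩
    enumerate X (index X (φ∈X i)) ≡⟨ cong (enumerate X) e ⟩
    enumerate X (index X (φ∈X j)) ≡⟨ enumerate-index X (φ∈X j) ⟩
    φ j                           ∎)
    where open ≡-Reasoning

∁-involutive : ∀ {m} (X : Subset m) → ∁ (∁ X) ≡ X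
∁-involutive []      = refl
∁-involutive (b ∷ X) = cong₂ _∷_ (not-involutive b) (∁-involutive X)

∣p∪⁅x⁆∣≡1+∣p∣ : ∀ {m} (X : Subset m) x → x ∉ X → ∣ X ∪ ⁅ x ⁆ ∣ ≡ suc ∣ X ∣
∣p∪⁅x⁆∣≡1+∣p∣ (inside  ∷ X) zero    x∉X = ⊥-elim (x∉X here)
∣p∪⁅x⁆∣≡1+∣p∣ (outside ∷ X) zero    _   = cong (λ Y → suc ∣ Y ∣) (∪-identityʳ X)
∣p∪⁅x⁆∣≡1+∣p∣ (inside  ∷ X) (suc x) x∉X = cong suc (∣p∪⁅x⁆∣≡1+∣p∣ X x (λ p → x∉X (there p)))
∣p∪⁅x⁆∣≡1+∣p∣ (outside ∷ X) (suc x) x∉X = ∣p∪⁅x⁆∣≡1+∣p∣ X x (λ p → x∉X (there p))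

∣p∪⁅x⁆∣+d : ∀ {m} (X : Subset m) x {d} → x ∉ X → ∣ X ∪ ⁅ x ⁆ ∣ + d ≡ ∣ X ∣ + suc d
∣p∪⁅x⁆∣+d X x {d} x∉X = trans (cong (_+ d) (∣p∪⁅x⁆∣≡1+∣p∣ X x x∉X)) (sym (+-suc ∣ X ∣ d))

∣⁅x⁆∪⁅y⁆∣≡2 : ∀ {m} {x y : Fin m} → x ≢ y → ∣ ⁅ x ⁆ ∪ ⁅ y ⁆ ∣ ≡ 2
∣⁅x⁆∪⁅y⁆∣≡2 {x = x} {y} x≢y =
  trans (∣p∪⁅x⁆∣≡1+∣p∣ ⁅ x ⁆ y (x≢y⇒x∉⁅y⁆ (λ y≡x → x≢y (sym y≡x)))) (cong suc (∣⁅x⁆∣≡1 x))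

⁅x⁆∪⁅y⁆⊆ : ∀ {m} {x y : Fin m} {X : Subset m} → x ∈ X → y ∈ X → ⁅ x ⁆ ∪ ⁅ y ⁆ ⊆ X
⁅x⁆∪⁅y⁆⊆ {x = x} {y} x∈X y∈X p with x∈p∪q⁻ ⁅ x ⁆ ⁅ y ⁆ p
... | inj₁ q = subst (_∈ _) (sym (x∈⁅y⁆⇒x≡y x q)) x∈X
... | inj₂ q = subst (_∈ _) (sym (x∈⁅y⁆⇒x≡y y q)) y∈X

distinct-element : ∀ {k} (e : Fin (suc (suc k))) → ∃ λ f → e ≢ f
distinct-element zero    = suc zero , λ ()
distinct-element (suc e) = zero , λ ()

module _ {m : ℕ} (M : Matroid m) where

  extend-by : ∀ {X} → Indep M X → ∀ d {S} → Indep M S → ∣ S ∣ + d ≤ ∣ X ∣ →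
              ∃ λ B → Indep M B × S ⊆ B × ∣ B ∣ ≡ ∣ S ∣ + d
  extend-by iX zero    {S} iS _ = S , iS , ⊆-refl , sym (+-identityʳ ∣ S ∣)
  extend-by {X} iX (suc d) {S} iS S+d≤X
    with augment M iS iX (<-≤-trans (m<m+n ∣ S ∣ z<s) S+d≤X)
  ... | y , _ , y∉S , iSy
    with extend-by iX d iSy (subst (_≤ ∣ X ∣) (sym (∣p∪⁅x⁆∣+d S y y∉S)) S+d≤X)
  ... | B , iB , S∪y⊆B , ∣B∣≡ =
    B , iB , (λ p → S∪y⊆B (p⊆p∪q ⁅ y ⁆ p)) , trans ∣B∣≡ (∣p∪⁅x⁆∣+d S y y∉S)

  extend-to-size : ∀ {X S n} → Indep M X → n ≤ ∣ X ∣ → Indep M S → ∣ S ∣ ≤ n →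
                   ∃ λ B → Indep M B × S ⊆ B × ∣ B ∣ ≡ n
  extend-to-size iX n≤X iS S≤n with m≤n⇒∃[o]m+o≡n S≤n
  ... | d , refl = extend-by iX d iS n≤X

  ∅-basis : BasisOf M ∅ ∅
  ∅-basis = ⊆-refl , indep-∅ M , λ x x∈∅ _ _ → ∉⊥ x∈∅

  minorIndep⇒indep : ∀ {C D X} → MinorIndep M C D X → Indep M X
  minorIndep⇒indep (_ , J , _ , iX∪J) = indep-⊆ M (p⊆p∪q J) iX∪J

  minorIso⇒≤∣ground∣ : ∀ {k} C D {N : IndepSystem k} → MinorIso M C D N →
                       k ≤ ∣ MinorGround M C D ∣
  minorIso⇒≤∣ground∣ C D (φ , φ-inj , ground , _) =
    injection-into⇒≤∣∣ φ φ-inj _ (λ i → from (ground (φ i)) (i , refl))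

  free-minor⇒ground-indep : ∀ {k} C D → MinorIso M C D (U k k) →
                            Indep M (MinorGround M C D)
  free-minor⇒ground-indep C D (φ , _ , _ , indep) =
    minorIndep⇒indep {C} {D} (from (indep G ⊆-refl) (∣p∣≤n (tabulate (λ i → lookup G (φ i)))))
    where G = MinorGround M C D

  restriction-ground : (B : Subset m) → MinorGround M ∅ (∁ B) ≡ B
  restriction-ground B = trans (cong ∁ (∪-identityˡ (∁ B))) (∁-involutive B)

  ∈-restriction-ground⁻ : ∀ {B x} → x ∈ MinorGround M ∅ (∁ B) → x ∈ B
  ∈-restriction-ground⁻ {B} {x} = subst (x ∈_) (restriction-ground B)

  ∈-restriction-ground⁺ : ∀ {B x} → x ∈ B → x ∈ MinorGround M ∅ (∁ B)
  ∈-restriction-ground⁺ {B} {x} = subst (x ∈_) (sym (restriction-ground B))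

  restriction-disjoint : (B : Subset m) → Empty (∅ ∩ ∁ B)
  restriction-disjoint B (x , x∈) = ∉⊥ (subst (x ∈_) (∩-zeroˡ (∁ B)) x∈)

  indep-restriction-free : ∀ {B} → Indep M B → MinorIso M ∅ (∁ B) (U ∣ B ∣ ∣ B ∣)
  indep-restriction-free {B} iB =
    enumerate B , enumerate-injective B ,
    (λ x → mk⇔ (λ x∈G → _ , enumerate-index B (∈-restriction-ground⁻ x∈G))
               (λ { (i , refl) → ∈-restriction-ground⁺ (enumerate-∈ B i) })) ,
    (λ X X⊆G → mk⇔ (λ _ → ∣p∣≤n (tabulate (λ i → lookup X (enumerate B i))))
      (λ _ → (λ {x} → X⊆G {x}) , ∅ , ∅-basis ,
             indep-⊆ M (λ {x} p → ∈-restriction-ground⁻ (X⊆G (subst (x ∈_) (∪-identityʳ X) p))) iB))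

  module _ {k : ℕ} where

    free-connected⇒simple : NConnected M (U k k) → Simple M
    free-connected⇒simple (s≤s (s≤s z≤n) , conn) = loopless , pairs
      where
      pairs : ∀ e f → e ≢ f → Indep M (⁅ e ⁆ ∪ ⁅ f ⁆)
      pairs e f e≢f with conn e f e≢f
      ... | C , D , _ , e∈G , f∈G , iso =
        indep-⊆ M (⁅x⁆∪⁅y⁆⊆ e∈G f∈G) (free-minor⇒ground-indep C D iso)
      loopless : ∀ e → Indep M ⁅ e ⁆
      loopless e with distinct-element e
      ... | f , e≢f = indep-⊆ M (p⊆p∪q ⁅ f ⁆) (pairs e f e≢f)

    free-connected⇒rank : NConnected M (U k k) → RankAtLeast M k
    free-connected⇒rank (s≤s (s≤s z≤n) , conn) with conn zero (suc zero) (λ ())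
    ... | C , D , _ , _ , _ , iso =
      MinorGround M C D , free-minor⇒ground-indep C D iso , minorIso⇒≤∣ground∣ C D {U k k} iso

    simple×rank⇒free-connected : 2 ≤ k → Simple M → RankAtLeast M k →
                                 NConnected M (U k k)
    simple×rank⇒free-connected 2≤k (_ , pairs) (X , iX , k≤X) =
      ≤-trans 2≤k (≤-trans k≤X (∣p∣≤n X)) , connect
      where
      connect : ∀ e f → e ≢ f → ∃ λ C → ∃ λ D → Empty (C ∩ D) ×
                  e ∈ MinorGround M C D × f ∈ MinorGround M C D × MinorIso M C D (U k k)
      connect e f e≢f
        with extend-to-size iX k≤X (pairs e f e≢f) (subst (_≤ k) (sym (∣⁅x⁆∪⁅y⁆∣≡2 e≢f)) 2≤k)
      ... | B , iB , ef⊆B , refl =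
        ∅ , ∁ B , restriction-disjoint B ,
        ∈-restriction-ground⁺ (ef⊆B (x∈p∪q⁺ (inj₁ (x∈⁅x⁆ e)))) ,
        ∈-restriction-ground⁺ (ef⊆B (x∈p∪q⁺ (inj₂ (x∈⁅x⁆ f)))) ,
        indep-restriction-free iB

proposition5p1 : (n : ℕ) → 2 ≤ n → {m : ℕ} → (M : Matroid m) →
    NConnected M (U n n) ⇔ (Simple M × RankAtLeast M n)
proposition5p1 n 2≤n M =
  mk⇔ (λ conn → free-connected⇒simple M conn , free-connected⇒rank M conn)
      (λ (simple , rank) → simple×rank⇒free-connected M 2≤n simple rank)
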